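{- Let $G$ and $H$ be connected non complete graphs. Let $g\in V(G)$ and let $h_1,h_2\in V(H)$ be two non adjacent vertices. Then $WT_{G[H]}((g,h_1),(g,h_2))=V(G[H])\setminus X$, where $$X=\{(g,x)\in V(G[H]) : x\notin WT_H(h_1,h_2) \text{ and } x \text{ is adjacent to exactly one of } h_1 \text{ and } h_2\}.$$
   Context: All graphs are finite, simple, connected and have at least two vertices. For vertices $u,v$ of a graph $G$, a weakly toll walk between $u$ and $v$ is a sequence $u=w_0,w_1,\ldots,w_k=v$ ($k\ge 0$) such that, when $k>0$: $w_iw_{i+1}\in E(G)$ for all $i\in\{0,\ldots,k-1\}$; $uw_i\in E(G)$ with $i\in\{1,\ldots,k\}$ implies $w_i=w_1$; and $w_iv\in E(G)$ with $i\in\{0,\ldots,k-1\}$ implies $w_i=w_{k-1}$. $WT_G(u,v)$ is the set of vertices lying on some weakly toll walk between $u$ and $v$. The lexicographic product $G[H]$ has vertex set $V(G)\times V(H)$, with $(g_1,h_1)(g_2,h_2)$ an edge iff $g_1g_2\in E(G)$, or $g_1=g_2$ and $h_1h_2\in E(H)$. -}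

module Defs where

open import Data.Nat using (ℕ; zero; suc; _≤_; _<_; _∸_)
open import Data.Fin using (Fin)
open import Data.Product using (Σ; ∃; _×_; _,_; proj₁; proj₂)
open import Data.Sum using (_⊎_)
open import Relation.Nullary using (¬_; Dec)
open import Relation.Binary.PropositionalEquality using (_≡_; _≢_)

record Graph : Set₁ where
  field
    n      : ℕ
    Adj    : Fin n → Fin n → Set
    adj?   : (u v : Fin n) → Dec (Adj u v)
    sym    : ∀ {u v} → Adj u v → Adj v u
    irrefl : ∀ {u} → ¬ Adj u u
open Graph public

V : Graph → Set
V G = Fin (n G)

-- Weakly toll walks for an arbitrary adjacency relation.
-- A walk of length k is w : ℕ → A, only w 0 … w k being relevant.
record IsWTWalk {A : Set} (E : A → A → Set) (u v : A) (k : ℕ) (w : ℕ → A) : Set where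
  field
    start : w 0 ≡ u
    end   : w k ≡ v
    edges : ∀ i → i < k → E (w i) (w (suc i))
    tollˡ : ∀ i → 1 ≤ i → i ≤ k → E u (w i) → w i ≡ w 1
    tollʳ : ∀ i → i < k → E (w i) v → w i ≡ w (k ∸ 1)

WTset : {A : Set} (E : A → A → Set) (u v x : A) → Set
WTset {A} E u v x =
  Σ ℕ λ k → Σ (ℕ → A) λ w → IsWTWalk E u v k w × Σ ℕ λ i → i ≤ k × w i ≡ x

record IsWalk {A : Set} (E : A → A → Set) (u v : A) (k : ℕ) (w : ℕ → A) : Set where
  field
    start : w 0 ≡ u
    end   : w k ≡ v
    edges : ∀ i → i < k → E (w i) (w (suc i))

Connected : Graph → Set
Connected G = ∀ (u v : V G) → Σ ℕ λ k → Σ (ℕ → V G) λ w → IsWalk (Adj G) u v k w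

NonComplete : Graph → Set
NonComplete G = Σ (V G) λ u → Σ (V G) λ v → u ≢ v × ¬ Adj G u v

AtLeastTwo : Graph → Set
AtLeastTwo G = 2 ≤ n G

LexAdj : (G H : Graph) → V G × V H → V G × V H → Set
LexAdj G H (g₁ , h₁) (g₂ , h₂) = Adj G g₁ g₂ ⊎ (g₁ ≡ g₂ × Adj H h₁ h₂)

InX : (G H : Graph) (g : V G) (h₁ h₂ : V H) → V G × V H → Set
InX G H g h₁ h₂ (g' , x) =
  g' ≡ g × ¬ WTset (Adj H) h₁ h₂ x ×
  ((Adj H x h₁ × ¬ Adj H x h₂) ⊎ (¬ Adj H x h₁ × Adj H x h₂))

-- Outside layer g, and inside it when x is adjacent to both or to neither of h₁, h₂, a vertex
-- is reached by a weakly toll walk that leaves layer g through a G-neighbour of g and returns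
-- the same way. If x is adjacent to exactly one hᵢ, then (g , x) can only occur next to
-- (g , hᵢ) on a weakly toll walk; every G-neighbour of g on the walk would be adjacent to
-- (g , hᵢ) and hence equal to (g , x), so the walk stays in layer g and projects to a weakly
-- toll walk of H, while walks of H lift to layer g. Constructively the remaining case needs
-- x ∈ WT_H(h₁, h₂) to be decidable: removing a closed subwalk keeps a walk weakly toll and
-- keeps its second and penultimate vertices, so walks of length at most |V(H)| + 1 suffice.

module Submission where

open import Defs hiding (sym)
open import Data.Nat using (ℕ; zero; suc; _+_; _∸_; _≤_; _<_; z≤n; s≤s)
open import Data.Nat.Properties
open import Data.Nat.Induction using (<-rec)
open import Data.Fin using (Fin; zero; suc; toℕ) renaming (_≟_ to _≟ᶠ_)
open import Data.Fin.Properties using (any?; pigeonhole; toℕ<n)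
open import Data.Product using (∃-syntax; _×_; _,_; proj₁; proj₂)
open import Data.Sum using (_⊎_; inj₁; inj₂)
open import Function using (_∘_)
open import Relation.Nullary using (¬_; yes; no; Dec; contradiction)
open import Relation.Nullary.Decidable using (_×-dec_; _⊎-dec_; _→-dec_; map′)
open import Relation.Binary.Definitions using (Decidable; DecidableEquality; Symmetric; tri<; tri≈; tri>)
open import Relation.Binary.PropositionalEquality
open import Function.Bundles using (_⇔_; mk⇔)

adj⇒≢ : (G : Graph) {a b : V G} → Adj G a b → a ≢ b
adj⇒≢ G ab refl = irrefl G ab

tollEnds : {A : Set} → ℕ → (ℕ → A) → A × A
tollEnds k w = w 1 , w (k ∸ 1)

_∈ᵖ_ : {A : Set} → A → A × A → Set
x ∈ᵖ (a , b) = x ≡ a ⊎ x ≡ b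

TollEndWalk : {A : Set} → (A → A → Set) → A → A → A → ℕ → (ℕ → A) → Set
TollEndWalk E u v x k w = IsWTWalk E u v k w × x ∈ᵖ tollEnds k w

module _ {A : Set} {E : A → A → Set} {u v : A} where

  IsWTWalk-resp : ∀ {k w w'} → (∀ i → i ≤ k → w i ≡ w' i) →
                  IsWTWalk E u v k w → IsWTWalk E u v k w'
  IsWTWalk-resp {k} {w} {w'} agree wk = record
    { start = trans (sym (agree 0 z≤n)) start
    ; end   = trans (sym (agree k ≤-refl)) end
    ; edges = λ i i<k → subst₂ E (agree i (<⇒≤ i<k)) (agree (suc i) i<k) (edges i i<k)
    ; tollˡ = λ i 1≤i i≤k e → trans (sym (agree i i≤k))
        (trans (tollˡ i 1≤i i≤k (subst (E u) (sym (agree i i≤k)) e)) (agree 1 (≤-trans 1≤i i≤k)))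
    ; tollʳ = λ i i<k e → trans (sym (agree i (<⇒≤ i<k)))
        (trans (tollʳ i i<k (subst (λ y → E y v) (sym (agree i (<⇒≤ i<k))) e)) (agree (k ∸ 1) (m∸n≤m k 1)))
    }
    where open IsWTWalk wk

  neighbourOfStart⇒second : ∀ {k w x} → IsWTWalk E u v k w → E u x → x ≢ u →
                            ∀ i → i ≤ k → w i ≡ x → x ≡ w 1
  neighbourOfStart⇒second wk ux x≢u zero _ w0≡x = contradiction (trans (sym w0≡x) (IsWTWalk.start wk)) x≢u
  neighbourOfStart⇒second wk ux x≢u (suc i) i≤k wi≡x =
    trans (sym wi≡x) (IsWTWalk.tollˡ wk (suc i) (s≤s z≤n) i≤k (subst (E u) (sym wi≡x) ux))

  neighbourOfEnd⇒penultimate : ∀ {k w x} → IsWTWalk E u v k w → E x v → x ≢ v →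
                               ∀ i → i ≤ k → w i ≡ x → x ≡ w (k ∸ 1)
  neighbourOfEnd⇒penultimate wk xv x≢v i i≤k wi≡x with m≤n⇒m<n∨m≡n i≤k
  ... | inj₂ refl = contradiction (trans (sym wi≡x) (IsWTWalk.end wk)) x≢v
  ... | inj₁ i<k = trans (sym wi≡x) (IsWTWalk.tollʳ wk i i<k (subst (λ y → E y v) (sym wi≡x) xv))

  tollEnd⇒WTset : u ≢ v → ∀ {k w x} → TollEndWalk E u v x k w → WTset E u v x
  tollEnd⇒WTset u≢v {zero} (wk , _) = contradiction (trans (sym (IsWTWalk.start wk)) (IsWTWalk.end wk)) u≢v
  tollEnd⇒WTset u≢v {suc k} {w} (wk , inj₁ x≡w₁) = suc k , w , wk , 1 , s≤s z≤n , sym x≡w₁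
  tollEnd⇒WTset u≢v {suc k} {w} (wk , inj₂ x≡wₖ) = suc k , w , wk , k , n≤1+n k , sym x≡wₖ

skipAfter : ℕ → ℕ → ℕ → ℕ
skipAfter a s i with i ≤? a
... | yes _ = i
... | no _ = i + s

skipAfter-≤ : ∀ {a} s {i} → i ≤ a → skipAfter a s i ≡ i
skipAfter-≤ {a} s {i} i≤a with i ≤? a
... | yes _ = refl
... | no i≰a = contradiction i≤a i≰a

skipAfter-> : ∀ {a} s {i} → a < i → skipAfter a s i ≡ i + s
skipAfter-> {a} s {i} a<i with i ≤? a
... | yes i≤a = contradiction i≤a (<⇒≱ a<i)
... | no _ = refl

i≤skipAfter : ∀ a s i → i ≤ skipAfter a s i
i≤skipAfter a s i with i ≤? a
... | yes _ = ≤-refl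
... | no _ = m≤m+n i s

skipAfter≤i+s : ∀ a s i → skipAfter a s i ≤ i + s
skipAfter≤i+s a s i with i ≤? a
... | yes _ = m≤m+n i s
... | no _ = ≤-refl

module _ {A : Set} {E : A → A → Set} {u v : A} where

  -- Every position of the shortened walk is an old one, so the toll conditions survive.
  deleteLoop : ∀ {a r s w} → IsWTWalk E u v (suc (a + r + s)) w → 1 ≤ a → w a ≡ w (a + s) →
               IsWTWalk E u v (suc (a + r)) (w ∘ skipAfter a s) ×
               tollEnds (suc (a + r)) (w ∘ skipAfter a s) ≡ tollEnds (suc (a + r + s)) w
  deleteLoop {a} {r} {s} {w} wk 1≤a loop = walk , cong₂ _,_ (cong w (skipAfter-≤ s 1≤a)) (lastKept r)
    where
      open IsWTWalk wk
      w' : ℕ → A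
      w' = w ∘ skipAfter a s

      lastKept : ∀ r → w' (a + r) ≡ w (a + r + s)
      lastKept (suc r') = cong w (skipAfter-> s (m<m+n a {suc r'} (s≤s z≤n)))
      lastKept zero rewrite +-identityʳ a = trans (cong w (skipAfter-≤ s ≤-refl)) loop

      shifted< : ∀ {i} → i < suc (a + r) → skipAfter a s i < suc (a + r + s)
      shifted< {i} i<k = ≤-trans (s≤s (skipAfter≤i+s a s i)) (+-monoˡ-≤ s i<k)

      walk : IsWTWalk E u v (suc (a + r)) w'
      walk = record
        { start = trans (cong w (skipAfter-≤ {a} s z≤n)) start
        ; end   = trans (cong w (skipAfter-> s (s≤s (m≤m+n a r)))) end
        ; edges = step
        ; tollˡ = λ i 1≤i i≤k e → trans (tollˡ (skipAfter a s i) (≤-trans 1≤i (i≤skipAfter a s i))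
                    (≤-trans (skipAfter≤i+s a s i) (+-monoˡ-≤ s i≤k)) e) (sym (cong w (skipAfter-≤ s 1≤a)))
        ; tollʳ = λ i i<k e → trans (tollʳ (skipAfter a s i) (shifted< i<k) e) (sym (lastKept r))
        }
        where
          step : ∀ i → i < suc (a + r) → E (w' i) (w' (suc i))
          step i i<k with <-cmp i a
          ... | tri< i<a _ _ = subst₂ E (cong w (sym (skipAfter-≤ s (<⇒≤ i<a)))) (cong w (sym (skipAfter-≤ s i<a)))
                                 (edges i (m<n⇒m<1+n (<-≤-trans i<a (≤-trans (m≤m+n a r) (m≤m+n (a + r) s)))))
          ... | tri≈ _ refl _ = subst₂ E (trans (sym loop) (cong w (sym (skipAfter-≤ s ≤-refl))))
                                 (cong w (sym (skipAfter-> s ≤-refl))) (edges (a + s) (s≤s (+-monoˡ-≤ s (m≤m+n a r))))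
          ... | tri> _ _ a<i = subst₂ E (cong w (sym (skipAfter-> s a<i))) (cong w (sym (skipAfter-> s (m<n⇒m<1+n a<i))))
                                 (edges (i + s) (+-monoˡ-≤ s i<k))

module _ {N : ℕ} {E : Fin N → Fin N → Set} {u v : Fin N} where

  -- Among the N + 1 positions 1 … N + 1 of a longer walk two carry the same vertex.
  shortenWTWalk : ∀ {k w} → IsWTWalk E u v k w → suc (suc N) ≤ k →
                  ∃[ k' ] ∃[ w' ] k' < k × IsWTWalk E u v k' w' × tollEnds k' w' ≡ tollEnds k w
  shortenWTWalk {k} {w} wk long with pigeonhole (n<1+n N) (w ∘ suc ∘ toℕ)
  ... | i , j , i<j , same =
        suc (a + r) , w ∘ skipAfter a s , shorter , proj₁ cut , trans (proj₂ cut) (cong (λ m → tollEnds m w) length≡)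
    where
      a b s r : ℕ
      a = suc (toℕ i)
      b = suc (toℕ j)
      s = toℕ j ∸ toℕ i
      r = k ∸ suc b

      a+s≡b : a + s ≡ b
      a+s≡b = cong suc (m+[n∸m]≡n (<⇒≤ i<j))

      length≡ : suc (a + r + s) ≡ k
      length≡ = begin
        suc (a + r + s)   ≡⟨ cong suc (+-assoc a r s) ⟩
        suc (a + (r + s)) ≡⟨ cong (λ t → suc (a + t)) (+-comm r s) ⟩
        suc (a + (s + r)) ≡⟨ cong suc (sym (+-assoc a s r)) ⟩
        suc (a + s + r)   ≡⟨ cong (λ t → suc t + r) a+s≡b ⟩
        suc b + r         ≡⟨ m+[n∸m]≡n (≤-trans (s≤s (toℕ<n j)) long) ⟩
        k                 ∎
        where open ≡-Reasoning

      shorter : suc (a + r) < k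
      shorter = subst (suc (a + r) <_) length≡ (s≤s (m<m+n (a + r) (m<n⇒0<n∸m i<j)))

      cut : IsWTWalk E u v (suc (a + r)) (w ∘ skipAfter a s) ×
            tollEnds (suc (a + r)) (w ∘ skipAfter a s) ≡ tollEnds (suc (a + r + s)) w
      cut = deleteLoop (subst (λ m → IsWTWalk E u v m w) (sym length≡) wk) (s≤s z≤n)
                       (trans same (cong w (sym a+s≡b)))

  boundWTWalk : ∀ {k w} → IsWTWalk E u v k w →
                ∃[ k' ] ∃[ w' ] k' ≤ suc N × IsWTWalk E u v k' w' × tollEnds k' w' ≡ tollEnds k w
  boundWTWalk {k} = <-rec Bounded bound k
    where
      Bounded : ℕ → Set
      Bounded k = ∀ {w} → IsWTWalk E u v k w →
                  ∃[ k' ] ∃[ w' ] k' ≤ suc N × IsWTWalk E u v k' w' × tollEnds k' w' ≡ tollEnds k w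
      bound : ∀ k → (∀ {k'} → k' < k → Bounded k') → Bounded k
      bound k shorter {w} wk with k ≤? suc N
      ... | yes k≤ = k , w , k≤ , wk , refl
      ... | no k≰ with shortenWTWalk wk (≰⇒> k≰)
      ...   | k' , w' , k'<k , wk' , ends with shorter k'<k wk'
      ...     | k'' , w'' , k''≤ , wk'' , ends' = k'' , w'' , k''≤ , wk'' , trans ends' ends

isWTWalk? : {A : Set} {E : A → A → Set} → DecidableEquality A → Decidable E →
            ∀ u v k w → Dec (IsWTWalk E u v k w)
isWTWalk? {E = E} _≟_ E? u v k w = map′ toWalk fromWalk
  ((w 0 ≟ u) ×-dec (w k ≟ v)
   ×-dec allUpTo? (λ i → E? (w i) (w (suc i))) k
   ×-dec allUpTo? (λ i → (1 ≤? i) →-dec (E? u (w i) →-dec (w i ≟ w 1))) (suc k)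
   ×-dec allUpTo? (λ i → E? (w i) v →-dec (w i ≟ w (k ∸ 1))) k)
  where
    Conditions : Set
    Conditions = w 0 ≡ u × w k ≡ v × (∀ {i} → i < k → E (w i) (w (suc i))) ×
                 (∀ {i} → i < suc k → 1 ≤ i → E u (w i) → w i ≡ w 1) ×
                 (∀ {i} → i < k → E (w i) v → w i ≡ w (k ∸ 1))
    toWalk : Conditions → IsWTWalk E u v k w
    toWalk (s , e , ed , tl , tr) = record
      { start = s ; end = e ; edges = λ i i<k → ed i<k
      ; tollˡ = λ i 1≤i i≤k → tl (s≤s i≤k) 1≤i ; tollʳ = λ i i<k → tr i<k }
    fromWalk : IsWTWalk E u v k w → Conditions
    fromWalk wk = start , end , (λ {i} → edges i) , (λ {i} i≤k 1≤i → tollˡ i 1≤i (≤-pred i≤k)) , (λ {i} → tollʳ i)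
      where open IsWTWalk wk

module _ {N : ℕ} where

  DeterminedBy : ℕ → ((ℕ → Fin N) → Set) → Set
  DeterminedBy m P = ∀ {w w'} → (∀ i → i < m → w i ≡ w' i) → P w → P w'

  _◂_ : Fin N → (ℕ → Fin N) → ℕ → Fin N
  (a ◂ w) zero = a
  (a ◂ w) (suc i) = w i

  ◂-agree : ∀ {m} a {w w'} → (∀ i → i < m → w i ≡ w' i) → ∀ i → i < suc m → (a ◂ w) i ≡ (a ◂ w') i
  ◂-agree a agree zero _ = refl
  ◂-agree a agree (suc i) (s≤s i<m) = agree i i<m

  ◂-split : (w : ℕ → Fin N) → ∀ i → w i ≡ (w 0 ◂ (w ∘ suc)) i
  ◂-split w zero = refl
  ◂-split w (suc i) = refl

  -- d only fills in the entries on which P does not depend.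
  ∃-determined? : Fin N → ∀ m {P : (ℕ → Fin N) → Set} →
                  (∀ w → Dec (P w)) → DeterminedBy m P → Dec (∃[ w ] P w)
  ∃-determined? d zero P? det with P? (λ _ → d)
  ... | yes p = yes (_ , p)
  ... | no ¬p = no λ (w , p) → ¬p (det (λ _ ()) p)
  ∃-determined? d (suc m) P? det with any? (λ a → ∃-determined? d m (P? ∘ (a ◂_)) (det ∘ ◂-agree a))
  ... | yes (a , w , p) = yes (a ◂ w , p)
  ... | no none = no λ (w , p) → none (w 0 , w ∘ suc , det (λ i _ → ◂-split w i) p)

module _ (H : Graph) {u v : V H} where

  tollEndWalk? : ∀ x k w → Dec (TollEndWalk (Adj H) u v x k w)
  tollEndWalk? x k w = isWTWalk? _≟ᶠ_ (adj? H) u v k w ×-dec ((x ≟ᶠ w 1) ⊎-dec (x ≟ᶠ w (k ∸ 1)))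

  tollEndWalk-determined : ∀ x k → DeterminedBy (suc (suc k)) (TollEndWalk (Adj H) u v x k)
  tollEndWalk-determined x k agree (wk , x∈) =
    IsWTWalk-resp (λ i i≤k → agree i (s≤s (m≤n⇒m≤1+n i≤k))) wk ,
    subst (x ∈ᵖ_) (cong₂ _,_ (agree 1 (s≤s (s≤s z≤n))) (agree (k ∸ 1) (s≤s (m≤n⇒m≤1+n (m∸n≤m k 1))))) x∈

  ∃tollEndWalk? : ∀ x → Dec (∃[ k ] ∃[ w ] TollEndWalk (Adj H) u v x k w)
  ∃tollEndWalk? x
    with anyUpTo? (λ k → ∃-determined? u (suc (suc k)) (tollEndWalk? x k) (tollEndWalk-determined x k)) (suc (suc (n H)))
  ... | yes (k , _ , w , found) = yes (k , w , found)
  ... | no none = no λ (k , w , wk , x∈) →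
          let (k' , w' , k'≤ , wk' , ends) = boundWTWalk wk
          in none (k' , s≤s k'≤ , w' , wk' , subst (x ∈ᵖ_) (sym ends) x∈)

  -- A neighbour x of an endpoint can only occur next to that endpoint on a weakly toll walk,
  -- so walks of bounded length suffice to decide membership.
  WTset-neighbour? : u ≢ v → ∀ x → Adj H u x ⊎ Adj H x v → Dec (WTset (Adj H) u v x)
  WTset-neighbour? u≢v x ux⊎xv =
    map′ (λ (k , w , x∈) → tollEnd⇒WTset u≢v x∈) (atTollEnd ux⊎xv) (∃tollEndWalk? x)
    where
      atTollEnd : Adj H u x ⊎ Adj H x v → WTset (Adj H) u v x → ∃[ k ] ∃[ w ] TollEndWalk (Adj H) u v x k w
      atTollEnd (inj₁ ux) (k , w , wk , i , i≤k , wi≡x) =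
        k , w , wk , inj₁ (neighbourOfStart⇒second wk ux (adj⇒≢ H (Graph.sym H ux)) i i≤k wi≡x)
      atTollEnd (inj₂ xv) (k , w , wk , i , i≤k , wi≡x) =
        k , w , wk , inj₂ (neighbourOfEnd⇒penultimate wk xv (adj⇒≢ H xv) i i≤k wi≡x)

bracket : {A : Set} → A → (ℕ → A) → ℕ → A → ℕ → A
bracket u c m v zero = u
bracket u c m v (suc i) with i ≤? m
... | yes _ = c i
... | no _ = v

bracket-inner : {A : Set} (u : A) (c : ℕ → A) {m : ℕ} (v : A) {i : ℕ} → i ≤ m → bracket u c m v (suc i) ≡ c i
bracket-inner u c {m} v {i} i≤m with i ≤? m
... | yes _ = refl
... | no i≰m = contradiction i≤m i≰m

bracket-end : {A : Set} (u : A) (c : ℕ → A) (m : ℕ) (v : A) → bracket u c m v (suc (suc m)) ≡ v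
bracket-end u c m v with suc m ≤? m
... | yes m<m = contradiction m<m (<-irrefl refl)
... | no _ = refl

module _ {A : Set} {E : A → A → Set} {u v : A} (u≁v : ¬ E u v) where

  bracket-WTWalk : ∀ {a b m c} → IsWalk E a b m c → E u a → E b v →
                   (∀ i → i ≤ m → E u (c i) → c i ≡ a) → (∀ i → i ≤ m → E (c i) v → c i ≡ b) →
                   IsWTWalk E u v (suc (suc m)) (bracket u c m v)
  bracket-WTWalk {a} {b} {m} {c} walk ua bv onlyA onlyB = record
    { start = refl
    ; end   = bracket-end u c m v
    ; edges = step
    ; tollˡ = tollˡ
    ; tollʳ = tollʳ
    }
    where
      open IsWalk walk
      inner : ∀ {i} → i ≤ m → bracket u c m v (suc i) ≡ c i
      inner = bracket-inner u c v

      second : bracket u c m v 1 ≡ a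
      second = trans (inner z≤n) start

      penultimate : bracket u c m v (suc m) ≡ b
      penultimate = trans (inner ≤-refl) end

      step : ∀ i → i < suc (suc m) → E (bracket u c m v i) (bracket u c m v (suc i))
      step zero _ = subst (E u) (sym second) ua
      step (suc i) (s≤s (s≤s i≤m)) with m≤n⇒m<n∨m≡n i≤m
      ... | inj₁ i<m = subst₂ E (sym (inner (<⇒≤ i<m))) (sym (inner i<m)) (edges i i<m)
      ... | inj₂ refl = subst₂ E (sym penultimate) (sym (bracket-end u c m v)) bv

      tollˡ : ∀ i → 1 ≤ i → i ≤ suc (suc m) → E u (bracket u c m v i) → bracket u c m v i ≡ bracket u c m v 1
      tollˡ (suc i) _ i≤k e with m≤n⇒m<n∨m≡n (≤-pred i≤k)
      ... | inj₁ (s≤s i≤m) = trans (inner i≤m) (trans (onlyA i i≤m (subst (E u) (inner i≤m) e)) (sym second))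
      ... | inj₂ refl = contradiction (subst (E u) (bracket-end u c m v) e) u≁v

      tollʳ : ∀ i → i < suc (suc m) → E (bracket u c m v i) v → bracket u c m v i ≡ bracket u c m v (suc m)
      tollʳ zero _ e = contradiction e u≁v
      tollʳ (suc i) (s≤s (s≤s i≤m)) e =
        trans (inner i≤m) (trans (onlyB i i≤m (subst (λ y → E y v) (inner i≤m) e)) (sym penultimate))

zigzag : ℕ → ℕ → ℕ
zigzag L i with i ≤? L
... | yes _ = i
... | no _ = L ∸ (i ∸ L)

zigzag-≤ : ∀ {L i} → i ≤ L → zigzag L i ≡ i
zigzag-≤ {L} {i} i≤L with i ≤? L
... | yes _ = refl
... | no i≰L = contradiction i≤L i≰L

zigzag-≥ : ∀ {L i} → L ≤ i → zigzag L i ≡ L ∸ (i ∸ L)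
zigzag-≥ {L} {i} L≤i with i ≤? L
... | no _ = refl
... | yes i≤L with ≤-antisym i≤L L≤i
...   | refl = sym (cong (L ∸_) (n∸n≡0 L))

zigzag≤ : ∀ L i → zigzag L i ≤ L
zigzag≤ L i with i ≤? L
... | yes i≤L = i≤L
... | no _ = m∸n≤m L (i ∸ L)

zigzag-end : ∀ L → zigzag L (L + L) ≡ 0
zigzag-end zero = refl
zigzag-end (suc L) = begin
  zigzag (suc L) (suc L + suc L)       ≡⟨ zigzag-≥ (m≤m+n (suc L) (suc L)) ⟩
  suc L ∸ (suc L + suc L ∸ suc L)      ≡⟨ cong (suc L ∸_) (m+n∸n≡m (suc L) (suc L)) ⟩
  suc L ∸ suc L                        ≡⟨ n∸n≡0 (suc L) ⟩
  0                                    ∎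
  where open ≡-Reasoning

m>n⇒m∸n≡1+m∸[1+n] : ∀ {m n} → n < m → m ∸ n ≡ suc (m ∸ suc n)
m>n⇒m∸n≡1+m∸[1+n] {suc m} {zero} _ = refl
m>n⇒m∸n≡1+m∸[1+n] {suc m} {suc n} (s≤s n<m) = m>n⇒m∸n≡1+m∸[1+n] n<m

zigzag-step : ∀ {L i} → i < L + L → zigzag L (suc i) ≡ suc (zigzag L i) ⊎ zigzag L i ≡ suc (zigzag L (suc i))
zigzag-step {L} {i} i<2L with <-≤-connex i L
... | inj₁ i<L = inj₁ (trans (zigzag-≤ i<L) (cong suc (sym (zigzag-≤ (<⇒≤ i<L)))))
... | inj₂ L≤i = inj₂ (begin
  zigzag L i                 ≡⟨ zigzag-≥ L≤i ⟩
  L ∸ (i ∸ L)                ≡⟨ m>n⇒m∸n≡1+m∸[1+n] i∸L<L ⟩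
  suc (L ∸ suc (i ∸ L))      ≡⟨ cong (λ d → suc (L ∸ d)) (sym (+-∸-assoc 1 L≤i)) ⟩
  suc (L ∸ (suc i ∸ L))      ≡⟨ cong suc (sym (zigzag-≥ (m≤n⇒m≤1+n L≤i))) ⟩
  suc (zigzag L (suc i))     ∎)
  where
    open ≡-Reasoning
    i∸L<L : i ∸ L < L
    i∸L<L = subst (i ∸ L <_) (m+n∸n≡m L L) (∸-monoˡ-< i<2L L≤i)

module _ {A : Set} {E : A → A → Set} (E-sym : Symmetric E) {u v : A} (u≁v : ¬ E u v) where

  -- The walk u, d 0, d 1, …, d L, …, d 1, d 0, v.
  outAndBack-WTset : (d : ℕ → A) (L : ℕ) → E u (d 0) → E (d 0) v →
                     (∀ t → t < L → E (d t) (d (suc t))) →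
                     (∀ t → t < L → ¬ E u (d (suc t)) × ¬ E (d (suc t)) v) →
                     ∀ t → t ≤ L → WTset E u v (d t)
  outAndBack-WTset d L ud dv steps far t t≤L =
    suc (suc (L + L)) , bracket u c (L + L) v ,
    bracket-WTWalk u≁v thereAndBack ud dv
      (onlyBase {E u} λ t t<L → proj₁ (far t t<L)) (onlyBase {λ y → E y v} λ t t<L → proj₂ (far t t<L)) ,
    suc t , s≤s (m≤n⇒m≤1+n t≤2L) , trans (bracket-inner u c v t≤2L) (cong d (zigzag-≤ t≤L))
    where
      c : ℕ → A
      c = d ∘ zigzag L

      t≤2L : t ≤ L + L
      t≤2L = ≤-trans t≤L (m≤m+n L L)

      thereAndBack : IsWalk E (d 0) (d 0) (L + L) c
      thereAndBack = record { start = cong d (zigzag-≤ {L} z≤n) ; end = cong d (zigzag-end L) ; edges = step }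
        where
          step : ∀ i → i < L + L → E (d (zigzag L i)) (d (zigzag L (suc i)))
          step i i<2L with zigzag-step i<2L
          ... | inj₁ up = subst (E (c i)) (sym (cong d up))
                            (steps (zigzag L i) (subst (_≤ L) up (zigzag≤ L (suc i))))
          ... | inj₂ down = subst (λ y → E y (c (suc i))) (sym (cong d down))
                              (E-sym (steps (zigzag L (suc i)) (subst (_≤ L) down (zigzag≤ L i))))

      onlyBase : {P : A → Set} → (∀ t → t < L → ¬ P (d (suc t))) →
                 ∀ i → i ≤ L + L → P (d (zigzag L i)) → d (zigzag L i) ≡ d 0
      onlyBase away i _ p with zigzag L i | zigzag≤ L i
      ... | zero | _ = refl
      ... | suc t | t<L = contradiction p (away t t<L)

Away : (G : Graph) → V G → V G → Set
Away G g y = y ≢ g × ¬ Adj G g y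

record Excursion (G : Graph) (g y : V G) : Set where
  field
    length : ℕ
    path   : ℕ → V G
    first  : Adj G g (path 0)
    last   : path length ≡ y
    steps  : ∀ t → t < length → Adj G (path t) (path (suc t))
    away   : ∀ t → t < length → Away G g (path (suc t))

-- Start at the last vertex of the walk that lies in the closed neighbourhood of g.
excursion : (G : Graph) {g y : V G} → y ≢ g → ∀ {m c} → IsWalk (Adj G) g y m c → Excursion G g y
excursion G {g} {y} y≢g {m} {c} walk = fromLastNear m ≤-refl (λ t m<t t≤m → contradiction t≤m (<⇒≱ m<t))
  where
    open IsWalk walk
    fromLastNear : ∀ s → s ≤ m → (∀ t → s < t → t ≤ m → Away G g (c t)) → Excursion G g y
    fromLastNear s s≤m beyond with adj? G g (c s) | c s ≟ᶠ g
    ... | yes g~cs | _ = record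
      { length = m ∸ s
      ; path   = λ t → c (t + s)
      ; first  = g~cs
      ; last   = trans (cong c (m∸n+n≡m s≤m)) end
      ; steps  = λ t t<len → edges (t + s) (inside t<len)
      ; away   = λ t t<len → beyond (suc (t + s)) (s≤s (m≤n+m s t)) (inside t<len)
      }
      where
        inside : ∀ {t} → t < m ∸ s → t + s < m
        inside t<len = subst (_ <_) (m∸n+n≡m s≤m) (+-monoˡ-< s t<len)
    ... | no _ | yes cs≡g with m≤n⇒m<n∨m≡n s≤m
    ...   | inj₁ s<m = contradiction (subst (λ z → Adj G z (c (suc s))) cs≡g (edges s s<m))
                                     (proj₂ (beyond (suc s) ≤-refl s<m))
    ...   | inj₂ refl = contradiction (trans (sym end) cs≡g) y≢g
    fromLastNear zero _ _ | no _ | no c0≢g = contradiction start c0≢g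
    fromLastNear (suc s) s<m beyond | no g≁cs | no cs≢g = fromLastNear s (<⇒≤ s<m) beyond′
      where
        beyond′ : ∀ t → s < t → t ≤ m → Away G g (c t)
        beyond′ t s<t t≤m with m≤n⇒m<n∨m≡n s<t
        ... | inj₁ s+1<t = beyond t s+1<t t≤m
        ... | inj₂ refl = cs≢g , g≁cs

module _ (G H : Graph) where

  LexAdj-sym : Symmetric (LexAdj G H)
  LexAdj-sym (inj₁ e) = inj₁ (Graph.sym G e)
  LexAdj-sym (inj₂ (eq , e)) = inj₂ (sym eq , Graph.sym H e)

  module _ {g : V G} {h₁ h₂ : V H} where

    liftWTset : ∀ {x} → WTset (Adj H) h₁ h₂ x → WTset (LexAdj G H) (g , h₁) (g , h₂) (g , x)
    liftWTset (k , w , wk , i , i≤k , wi≡x) = k , (g ,_) ∘ w , lifted , i , i≤k , cong (g ,_) wi≡x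
      where
        open IsWTWalk wk
        lifted : IsWTWalk (LexAdj G H) (g , h₁) (g , h₂) k ((g ,_) ∘ w)
        lifted = record
          { start = cong (g ,_) start
          ; end   = cong (g ,_) end
          ; edges = λ i i<k → inj₂ (refl , edges i i<k)
          ; tollˡ = λ { i 1≤i i≤k (inj₁ g~g) → contradiction g~g (irrefl G)
                      ; i 1≤i i≤k (inj₂ (_ , e)) → cong (g ,_) (tollˡ i 1≤i i≤k e) }
          ; tollʳ = λ { i i<k (inj₁ g~g) → contradiction g~g (irrefl G)
                      ; i i<k (inj₂ (_ , e)) → cong (g ,_) (tollʳ i i<k e) }
          }

    projectLayer : ∀ {k W} → IsWTWalk (LexAdj G H) (g , h₁) (g , h₂) k W →
                   (∀ j → 1 ≤ j → j ≤ k → ¬ Adj G g (proj₁ (W j))) →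
                   IsWTWalk (Adj H) h₁ h₂ k (proj₂ ∘ W)
    projectLayer {k} {W} wk noGNeighbour = record
      { start = cong proj₂ start
      ; end   = cong proj₂ end
      ; edges = step
      ; tollˡ = λ i 1≤i i≤k e → cong proj₂ (tollˡ i 1≤i i≤k (inj₂ (sym (layer i i≤k) , e)))
      ; tollʳ = λ i i<k e → cong proj₂ (tollʳ i i<k (inj₂ (layer i (<⇒≤ i<k) , e)))
      }
      where
        open IsWTWalk wk
        layer : ∀ i → i ≤ k → proj₁ (W i) ≡ g
        layer zero _ = cong proj₁ start
        layer (suc i) i<k with edges i i<k
        ... | inj₂ (same , _) = trans (sym same) (layer i (<⇒≤ i<k))
        ... | inj₁ e = contradiction (subst (λ z → Adj G z (proj₁ (W (suc i)))) (layer i (<⇒≤ i<k)) e)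
                                     (noGNeighbour (suc i) (s≤s z≤n) i<k)
        step : ∀ i → i < k → Adj H (proj₂ (W i)) (proj₂ (W (suc i)))
        step i i<k with edges i i<k
        ... | inj₂ (_ , e) = e
        ... | inj₁ e = contradiction (subst₂ (Adj G) (layer i (<⇒≤ i<k)) (layer (suc i) i<k) e) (irrefl G)

    -- A vertex (g , x) with x adjacent to h₁ (or h₂) sits next to that end of the walk, so a
    -- G-neighbour of g on the walk would be equal to (g , x); hence the walk never leaves layer g.
    projectWTset : ∀ {x} → Adj H h₁ x ⊎ Adj H x h₂ →
                   WTset (LexAdj G H) (g , h₁) (g , h₂) (g , x) → WTset (Adj H) h₁ h₂ x
    projectWTset {x} x~h (k , W , wk , i , i≤k , Wi≡gx) =
      k , proj₂ ∘ W , projectLayer wk (noGNeighbour (gxAtEnd x~h)) , i , i≤k , cong proj₂ Wi≡gx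
      where
        open IsWTWalk wk
        gxAtEnd : Adj H h₁ x ⊎ Adj H x h₂ → (g , x) ∈ᵖ tollEnds k W
        gxAtEnd (inj₁ h₁x) = inj₁ (neighbourOfStart⇒second wk (inj₂ (refl , h₁x))
                                     (adj⇒≢ H (Graph.sym H h₁x) ∘ cong proj₂) i i≤k Wi≡gx)
        gxAtEnd (inj₂ xh₂) = inj₂ (neighbourOfEnd⇒penultimate wk (inj₂ (refl , xh₂))
                                     (adj⇒≢ H xh₂ ∘ cong proj₂) i i≤k Wi≡gx)
        noGNeighbour : (g , x) ∈ᵖ tollEnds k W → ∀ j → 1 ≤ j → j ≤ k → ¬ Adj G g (proj₁ (W j))
        noGNeighbour (inj₁ gx≡W₁) j 1≤j j≤k g~Wj =
          irrefl G (subst (Adj G g) (cong proj₁ (trans (tollˡ j 1≤j j≤k (inj₁ g~Wj)) (sym gx≡W₁))) g~Wj)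
        noGNeighbour (inj₂ gx≡Wₖ) j 1≤j j≤k g~Wj with m≤n⇒m<n∨m≡n j≤k
        ... | inj₂ refl = irrefl G (subst (Adj G g) (cong proj₁ end) g~Wj)
        ... | inj₁ j<k = irrefl G (subst (Adj G g)
                           (cong proj₁ (trans (tollʳ j j<k (inj₁ (Graph.sym G g~Wj))) (sym gx≡Wₖ))) g~Wj)

    module _ (h₁≁h₂ : ¬ Adj H h₁ h₂) where

      ends≁ : ¬ LexAdj G H (g , h₁) (g , h₂)
      ends≁ (inj₁ g~g) = irrefl G g~g
      ends≁ (inj₂ (_ , h₁~h₂)) = h₁≁h₂ h₁~h₂

      otherLayer-WTset : Connected G → ∀ {g'} → g' ≢ g → ∀ y →
                         WTset (LexAdj G H) (g , h₁) (g , h₂) (g' , y)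
      otherLayer-WTset connected {g'} g'≢g y =
        subst (WTset (LexAdj G H) (g , h₁) (g , h₂)) (cong (_, y) last)
          (outAndBack-WTset LexAdj-sym ends≁ (λ t → path t , y) length
             (inj₁ first) (inj₁ (Graph.sym G first)) (λ t t<len → inj₁ (steps t t<len)) far length ≤-refl)
        where
          open Excursion (excursion G g'≢g (proj₂ (proj₂ (connected g g'))))
          far : ∀ t → t < length → ¬ LexAdj G H (g , h₁) (path (suc t) , y) × ¬ LexAdj G H (path (suc t) , y) (g , h₂)
          far t t<len with away t t<len
          ... | ≢g , g≁ = (λ { (inj₁ e) → g≁ e ; (inj₂ (eq , _)) → ≢g (sym eq) })
                        , (λ { (inj₁ e) → g≁ (Graph.sym G e) ; (inj₂ (eq , _)) → ≢g eq })

      commonNeighbour-WTset : ∀ {x} → Adj H x h₁ → Adj H x h₂ → WTset (LexAdj G H) (g , h₁) (g , h₂) (g , x)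
      commonNeighbour-WTset {x} xh₁ xh₂ =
        outAndBack-WTset LexAdj-sym ends≁ (λ _ → (g , x)) 0
          (inj₂ (refl , Graph.sym H xh₁)) (inj₂ (refl , xh₂)) (λ _ ()) (λ _ ()) 0 z≤n

      -- Step out to a G-neighbour a of g and come back: u, (a , x), (g , x), (a , x), v.
      nonNeighbour-WTset : ∀ {a x} → Adj G g a → ¬ Adj H x h₁ → ¬ Adj H x h₂ →
                           WTset (LexAdj G H) (g , h₁) (g , h₂) (g , x)
      nonNeighbour-WTset {a} {x} g~a x≁h₁ x≁h₂ =
        outAndBack-WTset LexAdj-sym ends≁ d 1 (inj₁ g~a) (inj₁ (Graph.sym G g~a)) step far 1 ≤-refl
        where
          d : ℕ → V G × V H
          d zero = (a , x)
          d (suc _) = (g , x)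
          step : ∀ t → t < 1 → LexAdj G H (d t) (d (suc t))
          step zero _ = inj₁ (Graph.sym G g~a)
          step (suc _) (s≤s ())
          far : ∀ t → t < 1 → ¬ LexAdj G H (g , h₁) (d (suc t)) × ¬ LexAdj G H (d (suc t)) (g , h₂)
          far zero _ = (λ { (inj₁ e) → irrefl G e ; (inj₂ (_ , e)) → x≁h₁ (Graph.sym H e) })
                     , (λ { (inj₁ e) → irrefl G e ; (inj₂ (_ , e)) → x≁h₂ e })
          far (suc _) (s≤s ())

otherVertex : ∀ {n} → 2 ≤ n → (g : Fin n) → ∃[ o ] o ≢ g
otherVertex (s≤s (s≤s _)) zero = suc zero , λ ()
otherVertex (s≤s (s≤s _)) (suc g) = zero , λ ()

neighbour : (G : Graph) → AtLeastTwo G → Connected G → (g : V G) → ∃[ a ] Adj G g a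
neighbour G two connected g with otherVertex two g
... | o , o≢g with connected g o
...   | zero , w , walk = contradiction (trans (sym (IsWalk.end walk)) (IsWalk.start walk)) o≢g
...   | suc k , w , walk = w 1 , subst (λ z → Adj G z (w 1)) (IsWalk.start walk) (IsWalk.edges walk 0 (s≤s z≤n))

mainTheorem10 : (G H : Graph) → AtLeastTwo G → AtLeastTwo H →
    Connected G → Connected H → NonComplete G → NonComplete H →
    (g : V G) (h₁ h₂ : V H) → h₁ ≢ h₂ → ¬ Adj H h₁ h₂ →
    (p : V G × V H) →
    WTset (LexAdj G H) (g , h₁) (g , h₂) p ⇔ (¬ InX G H g h₁ h₂ p)
mainTheorem10 G H twoG _ connG _ _ _ g h₁ h₂ h₁≢h₂ h₁≁h₂ (g' , x) = mk⇔ notInX fromNotInX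
  where
    ExactlyOne : Set
    ExactlyOne = (Adj H x h₁ × ¬ Adj H x h₂) ⊎ (¬ Adj H x h₁ × Adj H x h₂)

    adjacentToEnd : ExactlyOne → Adj H h₁ x ⊎ Adj H x h₂
    adjacentToEnd (inj₁ (xh₁ , _)) = inj₁ (Graph.sym H xh₁)
    adjacentToEnd (inj₂ (_ , xh₂)) = inj₂ xh₂

    notInX : WTset (LexAdj G H) (g , h₁) (g , h₂) (g' , x) → ¬ InX G H g h₁ h₂ (g' , x)
    notInX wt (refl , x∉WT , one) = x∉WT (projectWTset G H (adjacentToEnd one) wt)

    exactlyOne-WTset : ¬ InX G H g h₁ h₂ (g , x) → ExactlyOne → WTset (LexAdj G H) (g , h₁) (g , h₂) (g , x)
    exactlyOne-WTset ∉X one with WTset-neighbour? H h₁≢h₂ x (adjacentToEnd one)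
    ... | yes x∈WT = liftWTset G H x∈WT
    ... | no x∉WT = contradiction (refl , x∉WT , one) ∉X

    fromNotInX : ¬ InX G H g h₁ h₂ (g' , x) → WTset (LexAdj G H) (g , h₁) (g , h₂) (g' , x)
    fromNotInX ∉X with g' ≟ᶠ g
    ... | no g'≢g = otherLayer-WTset G H h₁≁h₂ connG g'≢g x
    ... | yes refl with adj? H x h₁ | adj? H x h₂
    ...   | yes xh₁ | yes xh₂ = commonNeighbour-WTset G H h₁≁h₂ xh₁ xh₂
    ...   | no x≁h₁ | no x≁h₂ = nonNeighbour-WTset G H h₁≁h₂ (proj₂ (neighbour G twoG connG g)) x≁h₁ x≁h₂
    ...   | yes xh₁ | no x≁h₂ = exactlyOne-WTset ∉X (inj₁ (xh₁ , x≁h₂))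
    ...   | no x≁h₁ | yes xh₂ = exactlyOne-WTset ∉X (inj₂ (x≁h₁ , xh₂))
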